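{- Let $G=(A,B,E)$ be a bipartite graph with a proper edge coloring $\chi:E\to\{1,\dots,d\}$. (a) If $G$ has no heavy path, then $|E|\le 2\sqrt{d|A|\,|B|}\le(|A|+|B|)\sqrt d$. (b) If $G$ has no slow walk, then $|E|\le(|A|+|B|)(\log d+2)$. (c) If $G$ has no fast walk, then $|E|\le 2(|A|+|B|)(\log d+2)$.
   Context: A bipartite graph is a triple $G=(A,B,E)$ with disjoint $A,B$ and $E\subseteq A\times B$; it is simple. A proper edge coloring gives adjacent edges distinct colors. A walk of length $m$ is $v_0,\dots,v_m$ with consecutive vertices adjacent and $v_{i-2}\ne v_i$; its coloring is the sequence of its edge colors. A heavy path is a path $v_0v_1v_2v_3$ with $v_0\in B$ and colors $c_1,c_2,c_3$ of its edges in order satisfying $c_2<c_1\le c_3$. A slow walk is a walk of length 4 with $v_0\in B$ and coloring satisfying $c_2<c_3<c_4$ and $c_2<c_1\le c_4$. A fast walk is a walk of length 4 (starting on either side) with coloring satisfying $c_2<c_3<c_4\le c_1$. $\log$ is the binary logarithm. -}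

module Defs where

open import Data.Nat using (ℕ; _+_)
open import Data.Bool using (Bool; true; false; if_then_else_)
open import Data.Fin using (Fin; _<_; _≤_)
open import Data.List using (map; allFin)
open import Data.Nat.ListAction using (sum)
open import Relation.Binary.PropositionalEquality using (_≡_; _≢_)

-- A (simple) bipartite graph G = (A, B, E) with A = Fin a, B = Fin b and
-- E ⊆ A × B given by its (decidable) indicator function.
record BipGraph (a b : ℕ) : Set where
  field
    adj : Fin a → Fin b → Bool

open BipGraph public

Edge : ∀ {a b} → BipGraph a b → Fin a → Fin b → Set
Edge G i j = adj G i j ≡ true

numEdges : ∀ {a b} → BipGraph a b → ℕ
numEdges {a} {b} G =
  sum (map (λ i → sum (map (λ j → if adj G i j then 1 else 0) (allFin b))) (allFin a))

-- An edge colouring with colours {1,…,d}, represented by Fin d (colour k+1 ↦ k;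
-- order preserving).  Only the values on edges are relevant.
Colouring : ℕ → ℕ → ℕ → Set
Colouring a b d = Fin a → Fin b → Fin d

Proper : ∀ {a b d} → BipGraph a b → Colouring a b d → Set
Proper {a} {b} G χ =
  (∀ (i : Fin a) (j j′ : Fin b) → Edge G i j → Edge G i j′ → j ≢ j′ → χ i j ≢ χ i j′)
  × (∀ (i i′ : Fin a) (j : Fin b) → Edge G i j → Edge G i′ j → i ≢ i′ → χ i j ≢ χ i′ j)
  where open import Data.Product using (_×_)

-- Heavy path v₀v₁v₂v₃ with v₀ ∈ B (so v₀,v₂ ∈ B and v₁,v₃ ∈ A).
-- Being a path amounts to v₀ ≢ v₂ and v₁ ≢ v₃ (vertices on different sides are distinct).
record HeavyPath {a b d} (G : BipGraph a b) (χ : Colouring a b d) : Set where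
  field
    v₀ : Fin b
    v₁ : Fin a
    v₂ : Fin b
    v₃ : Fin a
    e₁ : Edge G v₁ v₀
    e₂ : Edge G v₁ v₂
    e₃ : Edge G v₃ v₂
    d₀₂ : v₀ ≢ v₂
    d₁₃ : v₁ ≢ v₃
    c₂<c₁ : χ v₁ v₂ < χ v₁ v₀
    c₁≤c₃ : χ v₁ v₀ ≤ χ v₃ v₂

-- Slow walk v₀…v₄ with v₀ ∈ B (v₀,v₂,v₄ ∈ B, v₁,v₃ ∈ A), non-backtracking:
-- v₀ ≢ v₂, v₁ ≢ v₃, v₂ ≢ v₄.  Colours c₁…c₄ of edges v₀v₁,…,v₃v₄ satisfy
-- c₂ < c₃ < c₄ and c₂ < c₁ ≤ c₄.
record SlowWalk {a b d} (G : BipGraph a b) (χ : Colouring a b d) : Set where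
  field
    v₀ : Fin b
    v₁ : Fin a
    v₂ : Fin b
    v₃ : Fin a
    v₄ : Fin b
    e₁ : Edge G v₁ v₀
    e₂ : Edge G v₁ v₂
    e₃ : Edge G v₃ v₂
    e₄ : Edge G v₃ v₄
    d₀₂ : v₀ ≢ v₂
    d₁₃ : v₁ ≢ v₃
    d₂₄ : v₂ ≢ v₄
    c₂<c₃ : χ v₁ v₂ < χ v₃ v₂
    c₃<c₄ : χ v₃ v₂ < χ v₃ v₄
    c₂<c₁ : χ v₁ v₂ < χ v₁ v₀
    c₁≤c₄ : χ v₁ v₀ ≤ χ v₃ v₄

record FastWalkA {a b d} (G : BipGraph a b) (χ : Colouring a b d) : Set where
  field
    v₀ : Fin a
    v₁ : Fin b
    v₂ : Fin a
    v₃ : Fin b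
    v₄ : Fin a
    e₁ : Edge G v₀ v₁
    e₂ : Edge G v₂ v₁
    e₃ : Edge G v₂ v₃
    e₄ : Edge G v₄ v₃
    d₀₂ : v₀ ≢ v₂
    d₁₃ : v₁ ≢ v₃
    d₂₄ : v₂ ≢ v₄
    c₂<c₃ : χ v₂ v₁ < χ v₂ v₃
    c₃<c₄ : χ v₂ v₃ < χ v₄ v₃
    c₄≤c₁ : χ v₄ v₃ ≤ χ v₀ v₁

record FastWalkB {a b d} (G : BipGraph a b) (χ : Colouring a b d) : Set where
  field
    v₀ : Fin b
    v₁ : Fin a
    v₂ : Fin b
    v₃ : Fin a
    v₄ : Fin b
    e₁ : Edge G v₁ v₀
    e₂ : Edge G v₁ v₂
    e₃ : Edge G v₃ v₂
    e₄ : Edge G v₃ v₄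
    d₀₂ : v₀ ≢ v₂
    d₁₃ : v₁ ≢ v₃
    d₂₄ : v₂ ≢ v₄
    c₂<c₃ : χ v₁ v₂ < χ v₃ v₂
    c₃<c₄ : χ v₃ v₂ < χ v₃ v₄
    c₄≤c₁ : χ v₃ v₄ ≤ χ v₁ v₀

FastWalk : ∀ {a b d} → BipGraph a b → Colouring a b d → Set
FastWalk G χ = FastWalkA G χ ⊎ FastWalkB G χ
  where open import Data.Sum using (_⊎_)

module Submission where

-- For a vertex i let T(i) be its top colour and N(i, c) the least colour at i
-- above c (or d).  An edge of colour c is *tight at i* if
-- 2 (T(i) − N(i, c)) ≤ T(i) − c and *loose at i* otherwise.
--
-- Engine: a *doubling* set of naturals below B (of any two, the larger is at
-- least twice the smaller) has at most log B + 2 elements: 2^size ≤ 4B.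
--  * The tight edges at a vertex are doubling (values T(i) − c).
--  * (b) No slow walk: the edges at j ∈ B loose at their A-end are doubling
--    (values N(i, c) − c); charging each edge to one end, 2^|E| ≤ (4d)^(|A|+|B|).
--  * (c) No fast walk: an edge loose at both ends, charged to the end with the
--    smaller top colour, lies in a doubling set there (values N(j, c) − T(i));
--    each vertex carries two doubling sets, so 2^|E| ≤ (4d)^(2(|A|+|B|)).
--  * (a) No heavy path: for fixed i ∈ A the pairs (j, i′) with χ(ij) ≤ χ(i′j)
--    are determined by χ(i′j) and whether ij is the top edge at i, so there
--    are at most 2d; Cauchy–Schwarz over B gives |E|² ≤ 4d|A||B|, and AM–GM
--    gives 4d|A||B| ≤ (|A|+|B|)² d.

open import Defs
open import Data.Nat using (ℕ; zero; suc; _+_; _*_; _^_; _∸_; _≤_; _<_; _⊓_; _⊔_; _≤?_; _<?_; z≤n; s≤s)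
open import Data.Nat.Properties
open import Data.Nat.Tactic.RingSolver using (solve-∀)
open import Data.Bool using (Bool; true; false; _∧_; not; if_then_else_)
open import Data.Fin using (Fin; zero; suc; toℕ)
open import Data.Fin.Properties using (toℕ-injective; toℕ<n) renaming (_≟_ to _≟ᶠ_; suc-injective to sucᶠ-injective)
open import Data.List using (map; tabulate)
open import Data.Nat.ListAction using (sum)
open import Data.Product using (_×_; _,_; proj₁; proj₂; Σ-syntax)
open import Data.Sum using (_⊎_; inj₁; inj₂; swap; [_,_]′)
open import Data.Empty using (⊥-elim)
open import Function using (id; _∘_)
open import Relation.Nullary using (¬_; Dec; yes; no)
open import Relation.Nullary.Decidable using (⌊_⌋)
open import Relation.Binary.Definitions using (tri<; tri≈; tri>)
open import Relation.Binary.PropositionalEquality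
open import Algebra.Properties.CommutativeSemigroup +-commutativeSemigroup using (interchange)

ind : Bool → ℕ
ind x = if x then 1 else 0

ind≤1 : ∀ x → ind x ≤ 1
ind≤1 true  = s≤s z≤n
ind≤1 false = z≤n

ind-true : ∀ {x} → 1 ≤ ind x → x ≡ true
ind-true {true} _ = refl

∧-true : ∀ {x y} → x ∧ y ≡ true → x ≡ true × y ≡ true
∧-true {true} {true} _ = refl , refl

not-true : ∀ {x} → not x ≡ true → x ≡ false
not-true {false} _ = refl

witness : ∀ {A : Set} (A? : Dec A) → ⌊ A? ⌋ ≡ true → A
witness (yes a) _ = a

refutation : ∀ {A : Set} (A? : Dec A) → ⌊ A? ⌋ ≡ false → ¬ A
refutation (no ¬a) _ = ¬a

≤?-flip : ∀ m n → ⌊ m ≤? n ⌋ ≡ false → ⌊ n ≤? m ⌋ ≡ true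
≤?-flip m n m≰n with n ≤? m
... | yes _   = refl
... | no n≰m = ⊥-elim (n≰m (<⇒≤ (≰⇒> (refutation (m ≤? n) m≰n))))

∑ : ∀ n → (Fin n → ℕ) → ℕ
∑ zero    f = 0
∑ (suc n) f = f zero + ∑ n (λ i → f (suc i))

syntax ∑ n (λ i → e) = ∑[ i < n ] e

∑-cong : ∀ n {f g : Fin n → ℕ} → (∀ i → f i ≡ g i) → ∑ n f ≡ ∑ n g
∑-cong zero    f≡g = refl
∑-cong (suc n) f≡g = cong₂ _+_ (f≡g zero) (∑-cong n (f≡g ∘ suc))

∑-mono : ∀ n {f g : Fin n → ℕ} → (∀ i → f i ≤ g i) → ∑ n f ≤ ∑ n g
∑-mono zero    f≤g = z≤n
∑-mono (suc n) f≤g = +-mono-≤ (f≤g zero) (∑-mono n (f≤g ∘ suc))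

∑-const : ∀ n k → ∑[ _ < n ] k ≡ n * k
∑-const zero    k = refl
∑-const (suc n) k = cong (k +_) (∑-const n k)

∑-zero : ∀ n {f : Fin n → ℕ} → (∀ i → f i ≡ 0) → ∑ n f ≡ 0
∑-zero n f≡0 = trans (∑-cong n f≡0) (trans (∑-const n 0) (*-zeroʳ n))

∑-distrib-+ : ∀ n (f g : Fin n → ℕ) → ∑[ i < n ] (f i + g i) ≡ ∑ n f + ∑ n g
∑-distrib-+ zero    f g = refl
∑-distrib-+ (suc n) f g =
  trans (cong (f zero + g zero +_) (∑-distrib-+ n (f ∘ suc) (g ∘ suc)))
        (interchange (f zero) (g zero) (∑ n (f ∘ suc)) (∑ n (g ∘ suc)))

∑-*ˡ : ∀ n k (f : Fin n → ℕ) → k * ∑ n f ≡ ∑[ i < n ] (k * f i)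
∑-*ˡ zero    k f = *-zeroʳ k
∑-*ˡ (suc n) k f = trans (*-distribˡ-+ k (f zero) _) (cong (k * f zero +_) (∑-*ˡ n k (f ∘ suc)))

∑-*ʳ : ∀ n k (f : Fin n → ℕ) → ∑ n f * k ≡ ∑[ i < n ] (f i * k)
∑-*ʳ zero    k f = refl
∑-*ʳ (suc n) k f = trans (*-distribʳ-+ k (f zero) _) (cong (f zero * k +_) (∑-*ʳ n k (f ∘ suc)))

∑-product : ∀ n m (f : Fin n → ℕ) (g : Fin m → ℕ) →
  ∑ n f * ∑ m g ≡ ∑[ i < n ] ∑[ j < m ] (f i * g j)
∑-product n m f g = trans (∑-*ʳ n (∑ m g) f) (∑-cong n (λ i → ∑-*ˡ m (f i) g))

∑-swap : ∀ n m (f : Fin n → Fin m → ℕ) →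
  ∑[ i < n ] ∑[ j < m ] f i j ≡ ∑[ j < m ] ∑[ i < n ] f i j
∑-swap zero    m f = sym (∑-zero m (λ _ → refl))
∑-swap (suc n) m f = begin
  ∑ m (f zero) + ∑[ i < n ] ∑ m (f (suc i))
    ≡⟨ cong (∑ m (f zero) +_) (∑-swap n m (f ∘ suc)) ⟩
  ∑ m (f zero) + ∑[ j < m ] ∑[ i < n ] f (suc i) j
    ≡⟨ sym (∑-distrib-+ m (f zero) _) ⟩
  ∑[ j < m ] (f zero j + ∑[ i < n ] f (suc i) j) ∎
  where open ≡-Reasoning

∑-positive : ∀ n (f : Fin n → ℕ) → 1 ≤ ∑ n f → Σ[ i ∈ Fin n ] 1 ≤ f i
∑-positive (suc n) f pos with f zero in eq
... | suc _ = zero , subst (1 ≤_) (sym eq) (s≤s z≤n)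
... | zero  = let (i , p) = ∑-positive n (f ∘ suc) pos in suc i , p

∑-≤1 : ∀ n (f : Fin n → ℕ) → (∀ i → f i ≤ 1) → (∀ i j → 1 ≤ f i → 1 ≤ f j → i ≡ j) → ∑ n f ≤ 1
∑-≤1 zero    f f≤1 unique = z≤n
∑-≤1 (suc n) f f≤1 unique with f zero in eq
... | zero  = ∑-≤1 n (f ∘ suc) (f≤1 ∘ suc) (λ i j p q → sucᶠ-injective (unique (suc i) (suc j) p q))
... | suc x = begin
  suc x + ∑ n (f ∘ suc) ≡⟨ cong (suc x +_) (∑-zero n rest-zero) ⟩
  suc x + 0             ≡⟨ +-identityʳ (suc x) ⟩
  suc x                 ≡⟨ sym eq ⟩
  f zero                ≤⟨ f≤1 zero ⟩
  1                     ∎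
  where
  open ≤-Reasoning
  rest-zero : ∀ i → f (suc i) ≡ 0
  rest-zero i with f (suc i) in eq′
  ... | zero  = refl
  ... | suc _ with unique zero (suc i) (subst (1 ≤_) (sym eq) (s≤s z≤n)) (subst (1 ≤_) (sym eq′) (s≤s z≤n))
  ... | ()

∑∑-≤1 : ∀ n m (f : Fin n → Fin m → ℕ) → (∀ i j → f i j ≤ 1) →
  (∀ i j i′ j′ → 1 ≤ f i j → 1 ≤ f i′ j′ → i ≡ i′ × j ≡ j′) →
  ∑[ i < n ] ∑[ j < m ] f i j ≤ 1
∑∑-≤1 n m f f≤1 unique = ∑-≤1 n (λ i → ∑ m (f i))
  (λ i → ∑-≤1 m (f i) (f≤1 i) (λ j j′ p q → proj₂ (unique i j i j′ p q)))
  (λ i i′ p q → let (j , pj) = ∑-positive m (f i) p ; (j′ , pj′) = ∑-positive m (f i′) q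
                in proj₁ (unique i j i′ j′ pj pj′))

2^∑≤ : ∀ n (f : Fin n → ℕ) M → (∀ i → 2 ^ f i ≤ M) → 2 ^ ∑ n f ≤ M ^ n
2^∑≤ zero    f M bound = ≤-refl
2^∑≤ (suc n) f M bound = begin
  2 ^ (f zero + ∑ n (f ∘ suc))   ≡⟨ ^-distribˡ-+-* 2 (f zero) _ ⟩
  2 ^ f zero * 2 ^ ∑ n (f ∘ suc) ≤⟨ *-mono-≤ (bound zero) (2^∑≤ n (f ∘ suc) M (bound ∘ suc)) ⟩
  M * M ^ n                      ∎
  where open ≤-Reasoning

pigeonhole : ∀ n m d (P : Fin n → Fin m → Bool) (f : Fin n → Fin m → Fin d) →
  (∀ i j i′ j′ → P i j ≡ true → P i′ j′ ≡ true → f i j ≡ f i′ j′ → i ≡ i′ × j ≡ j′) →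
  ∑[ i < n ] ∑[ j < m ] ind (P i j) ≤ d
pigeonhole n m d P f f-inj = begin
  ∑[ i < n ] ∑[ j < m ] ind (P i j)
    ≡⟨ ∑-cong n (λ i → ∑-cong m (λ j → by-colour (P i j) (f i j))) ⟩
  ∑[ i < n ] ∑[ j < m ] ∑[ c < d ] class c i j
    ≡⟨ ∑-cong n (λ i → ∑-swap m d (λ j c → class c i j)) ⟩
  ∑[ i < n ] ∑[ c < d ] ∑[ j < m ] class c i j
    ≡⟨ ∑-swap n d (λ i c → ∑ m (class c i)) ⟩
  ∑[ c < d ] ∑[ i < n ] ∑[ j < m ] class c i j
    ≤⟨ ∑-mono d (λ c → ∑∑-≤1 n m (class c) (λ i j → ind≤1 _) (class-unique c)) ⟩
  ∑[ _ < d ] 1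
    ≡⟨ trans (∑-const d 1) (*-identityʳ d) ⟩
  d ∎
  where
  open ≤-Reasoning
  class : Fin d → Fin n → Fin m → ℕ
  class c i j = ind (P i j ∧ ⌊ f i j ≟ᶠ c ⌋)

  one-colour : ∀ {k} (x : Fin k) → ∑[ c < k ] ind ⌊ x ≟ᶠ c ⌋ ≡ 1
  one-colour {suc k} zero    = cong suc (∑-zero k (λ _ → refl))
  one-colour {suc k} (suc x) = trans (∑-cong k shift) (one-colour x)
    where
    shift : ∀ c → ind ⌊ suc x ≟ᶠ suc c ⌋ ≡ ind ⌊ x ≟ᶠ c ⌋
    shift c with x ≟ᶠ c
    ... | yes _ = refl
    ... | no _  = refl

  by-colour : ∀ x (y : Fin d) → ind x ≡ ∑[ c < d ] ind (x ∧ ⌊ y ≟ᶠ c ⌋)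
  by-colour true  y = sym (one-colour y)
  by-colour false y = sym (∑-zero d (λ _ → refl))

  class-unique : ∀ c i j i′ j′ → 1 ≤ class c i j → 1 ≤ class c i′ j′ → i ≡ i′ × j ≡ j′
  class-unique c i j i′ j′ p q =
    let (Pij , fij) = ∧-true (ind-true p) ; (Pij′ , fij′) = ∧-true (ind-true q)
    in f-inj i j i′ j′ Pij Pij′ (trans (witness (_ ≟ᶠ _) fij) (sym (witness (_ ≟ᶠ _) fij′)))

am-gm : ∀ x y → 2 * (x * y) ≤ x * x + y * y
am-gm x y = [ ordered , (λ y≤x → subst₂ _≤_ (cong (2 *_) (*-comm y x)) (+-comm (y * y) (x * x)) (ordered y≤x)) ]′
              (≤-total x y)
  where
  square-gap : ∀ x k → x * x + (x + k) * (x + k) ≡ 2 * (x * (x + k)) + k * k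
  square-gap = solve-∀

  ordered : ∀ {x y} → x ≤ y → 2 * (x * y) ≤ x * x + y * y
  ordered {x} x≤y with m≤n⇒∃[o]m+o≡n x≤y
  ... | k , refl = subst (2 * (x * (x + k)) ≤_) (sym (square-gap x k)) (m≤m+n _ _)

-- Cauchy–Schwarz: (∑ f)² ≤ n ∑ f², from AM–GM on every pair of terms.
cauchy-schwarz : ∀ n (f : Fin n → ℕ) → ∑ n f * ∑ n f ≤ n * ∑[ i < n ] (f i * f i)
cauchy-schwarz n f = *-cancelˡ-≤ 2 (begin
  2 * (∑ n f * ∑ n f)
    ≡⟨ cong (2 *_) (∑-product n n f f) ⟩
  2 * ∑[ i < n ] ∑[ k < n ] (f i * f k)
    ≡⟨ trans (∑-*ˡ n 2 _) (∑-cong n (λ i → ∑-*ˡ n 2 _)) ⟩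
  ∑[ i < n ] ∑[ k < n ] (2 * (f i * f k))
    ≤⟨ ∑-mono n (λ i → ∑-mono n (λ k → am-gm (f i) (f k))) ⟩
  ∑[ i < n ] ∑[ k < n ] (f i * f i + f k * f k)
    ≡⟨ trans (∑-cong n (λ i → ∑-distrib-+ n _ _)) (∑-distrib-+ n _ _) ⟩
  ∑[ i < n ] ∑[ _ < n ] (f i * f i) + ∑[ _ < n ] squares
    ≡⟨ cong₂ _+_ (trans (∑-cong n (λ i → ∑-const n (f i * f i))) (sym (∑-*ˡ n n _))) (∑-const n squares) ⟩
  n * squares + n * squares
    ≡⟨ cong (n * squares +_) (sym (+-identityʳ (n * squares))) ⟩
  2 * (n * squares) ∎)
  where
  open ≤-Reasoning
  squares = ∑[ i < n ] (f i * f i)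

_≪_ : ℕ → ℕ → Set
x ≪ y = x < y × 2 * x ≤ y

twice-below⇒≪ : ∀ {x y} → 2 * x < y → x ≪ y
twice-below⇒≪ {x} 2x<y = ≤-<-trans (m≤m+n x (x + 0)) 2x<y , <⇒≤ 2x<y

Doubling : ∀ n → (Fin n → Bool) → (Fin n → ℕ) → Set
Doubling n P μ = ∀ p q → P p ≡ true → P q ≡ true → p ≢ q → μ p ≪ μ q ⊎ μ q ≪ μ p

doubling-by-key : ∀ {n} (P : Fin n → Bool) (μ κ : Fin n → ℕ) →
  (∀ p q → P p ≡ true → P q ≡ true → κ p ≡ κ q → p ≡ q) →
  (∀ p q → P p ≡ true → P q ≡ true → p ≢ q → κ p < κ q → μ p ≪ μ q ⊎ μ q ≪ μ p) →
  Doubling n P μ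
doubling-by-key P μ κ κ-inj ordered p q Pp Pq p≢q with <-cmp (κ p) (κ q)
... | tri< κp<κq _ _ = ordered p q Pp Pq p≢q κp<κq
... | tri≈ _ κp≡κq _ = ⊥-elim (p≢q (κ-inj p q Pp Pq κp≡κq))
... | tri> _ _ κq<κp = swap (ordered q p Pq Pp (p≢q ∘ sym) κq<κp)

-- Counting a doubling set by dyadic blocks: members with value below 2^k
-- number at most k + 1, since [0, 1) and each block [2^k, 2^(k+1)) hold at
-- most one member.
module DyadicCount {n : ℕ} (P : Fin n → Bool) (μ : Fin n → ℕ) (doubling : Doubling n P μ) where

  below : ℕ → Fin n → Bool
  below m p = P p ∧ ⌊ μ p <? m ⌋

  block : ℕ → Fin n → Bool
  block k p = P p ∧ ⌊ 2 ^ k ≤? μ p ⌋ ∧ ⌊ μ p <? 2 ^ suc k ⌋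

  at-most-one : (Q : Fin n → Bool) → (∀ p → Q p ≡ true → P p ≡ true) →
    (∀ p q → Q p ≡ true → Q q ≡ true → ¬ μ p ≪ μ q) → ∑[ p < n ] ind (Q p) ≤ 1
  at-most-one Q Q⊆P unrelated = ∑-≤1 n _ (ind≤1 ∘ Q) unique
    where
    unique : ∀ p q → 1 ≤ ind (Q p) → 1 ≤ ind (Q q) → p ≡ q
    unique p q Qp Qq with p ≟ᶠ q
    ... | yes p≡q = p≡q
    ... | no p≢q with doubling p q (Q⊆P p (ind-true Qp)) (Q⊆P q (ind-true Qq)) p≢q
    ... | inj₁ p≪q = ⊥-elim (unrelated p q (ind-true Qp) (ind-true Qq) p≪q)
    ... | inj₂ q≪p = ⊥-elim (unrelated q p (ind-true Qq) (ind-true Qp) q≪p)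

  below-one : ∑[ p < n ] ind (below 1 p) ≤ 1
  below-one = at-most-one (below 1) (λ p → proj₁ ∘ ∧-true) unrelated
    where
    unrelated : ∀ p q → below 1 p ≡ true → below 1 q ≡ true → ¬ μ p ≪ μ q
    unrelated p q _ q-below (μp<μq , _) =
      n≮0 (<-≤-trans μp<μq (≤-pred (witness (μ q <? 1) (proj₂ (∧-true {P q} q-below)))))

  block-one : ∀ k → ∑[ p < n ] ind (block k p) ≤ 1
  block-one k = at-most-one (block k) (λ p → proj₁ ∘ ∧-true) unrelated
    where
    unrelated : ∀ p q → block k p ≡ true → block k q ≡ true → ¬ μ p ≪ μ q
    unrelated p q p-block q-block (_ , 2μp≤μq) =
      let 2^k≤μp = witness (2 ^ k ≤? μ p) (proj₁ (∧-true (proj₂ (∧-true {P p} p-block))))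
          μq<2^k+1 = witness (μ q <? 2 ^ suc k) (proj₂ (∧-true (proj₂ (∧-true {P q} q-block))))
      in <-irrefl refl (<-≤-trans μq<2^k+1 (≤-trans (*-monoʳ-≤ 2 2^k≤μp) 2μp≤μq))

  below-split : ∀ k p → ind (below (2 ^ suc k) p) ≤ ind (below (2 ^ k) p) + ind (block k p)
  below-split k p with P p
  ... | false = z≤n
  ... | true with μ p <? 2 ^ suc k
  ... | no _ = z≤n
  ... | yes _ with μ p <? 2 ^ k
  ... | yes _ = s≤s z≤n
  ... | no μp≮2^k with 2 ^ k ≤? μ p
  ... | yes _ = s≤s z≤n
  ... | no 2^k≰μp = ⊥-elim (2^k≰μp (≮⇒≥ μp≮2^k))

  count-below : ∀ k → ∑[ p < n ] ind (below (2 ^ k) p) ≤ suc k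
  count-below zero    = below-one
  count-below (suc k) = begin
    ∑[ p < n ] ind (below (2 ^ suc k) p)
      ≤⟨ ∑-mono n (below-split k) ⟩
    ∑[ p < n ] (ind (below (2 ^ k) p) + ind (block k p))
      ≡⟨ ∑-distrib-+ n _ _ ⟩
    ∑[ p < n ] ind (below (2 ^ k) p) + ∑[ p < n ] ind (block k p)
      ≤⟨ +-mono-≤ (count-below k) (block-one k) ⟩
    suc k + 1
      ≡⟨ +-comm (suc k) 1 ⟩
    suc (suc k) ∎
    where open ≤-Reasoning

power-of-two-between : ∀ B → Σ[ k ∈ ℕ ] (suc B ≤ 2 ^ k × 2 ^ k ≤ 2 * suc B)
power-of-two-between zero = 0 , s≤s z≤n , s≤s z≤n
power-of-two-between (suc B) with power-of-two-between B
... | k , B<2^k , 2^k≤2B+2 with suc (suc B) ≤? 2 ^ k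
...   | yes B+1<2^k = k , B+1<2^k , ≤-trans 2^k≤2B+2 (*-monoʳ-≤ 2 (n≤1+n (suc B)))
...   | no B+1≮2^k = suc k , subst (suc (suc B) ≤_) (cong (2 *_) (sym 2^k≡B+1)) B+2≤2B+2 ,
                            subst (_≤ 2 * suc (suc B)) (cong (2 *_) (sym 2^k≡B+1)) (*-monoʳ-≤ 2 (n≤1+n (suc B)))
  where
  2^k≡B+1 : 2 ^ k ≡ suc B
  2^k≡B+1 = ≤-antisym (≤-pred (≰⇒> B+1≮2^k)) B<2^k
  B+2≤2B+2 : suc (suc B) ≤ 2 * suc B
  B+2≤2B+2 = s≤s (subst (suc B ≤_) (sym (+-suc B (B + 0))) (s≤s (m≤m+n B (B + 0))))

doubling-small : ∀ {n} (P : Fin n → Bool) (μ : Fin n → ℕ) B → 1 ≤ B →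
  (∀ p → P p ≡ true → μ p < B) → Doubling n P μ → 2 ^ ∑[ p < n ] ind (P p) ≤ 4 * B
doubling-small {n} P μ (suc B) _ μ<B doubling with power-of-two-between B
... | k , B<2^k , 2^k≤2B = begin
  2 ^ ∑[ p < n ] ind (P p)             ≡⟨ cong (2 ^_) (∑-cong n all-below) ⟩
  2 ^ ∑[ p < n ] ind (below (2 ^ k) p) ≤⟨ ^-monoʳ-≤ 2 (count-below k) ⟩
  2 * 2 ^ k                            ≤⟨ *-monoʳ-≤ 2 2^k≤2B ⟩
  2 * (2 * suc B)                      ≡⟨ sym (*-assoc 2 2 (suc B)) ⟩
  4 * suc B                            ∎
  where
  open ≤-Reasoning
  open DyadicCount P μ doubling
  all-below : ∀ p → ind (P p) ≡ ind (below (2 ^ k) p)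
  all-below p with P p in Pp
  ... | false = refl
  ... | true with μ p <? 2 ^ k
  ... | yes _ = refl
  ... | no μp≮2^k = ⊥-elim (μp≮2^k (<-≤-trans (μ<B p Pp) B<2^k))

maxOn : ∀ n → (Fin n → Bool) → (Fin n → ℕ) → ℕ
maxOn zero    m c = 0
maxOn (suc n) m c = (if m zero then c zero else 0) ⊔ maxOn n (m ∘ suc) (c ∘ suc)

maxOn-upper : ∀ n m c (j : Fin n) → m j ≡ true → c j ≤ maxOn n m c
maxOn-upper (suc n) m c zero    mj rewrite mj = m≤m⊔n _ _
maxOn-upper (suc n) m c (suc j) mj = ≤-trans (maxOn-upper n (m ∘ suc) (c ∘ suc) j mj) (m≤n⊔m _ _)

maxOn-attained : ∀ n m c (j : Fin n) → m j ≡ true → Σ[ k ∈ Fin n ] (m k ≡ true × c k ≡ maxOn n m c)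
maxOn-attained n m c j mj with maxOn n m c in eq
... | zero  = j , mj , n≤0⇒n≡0 (subst (c j ≤_) eq (maxOn-upper n m c j mj))
... | suc _ = let (k , mk , ck) = positive n m c (subst (0 <_) (sym eq) (s≤s z≤n)) in k , mk , trans ck eq
  where
  positive : ∀ n m c → 0 < maxOn n m c → Σ[ k ∈ Fin n ] (m k ≡ true × c k ≡ maxOn n m c)
  positive (suc n) m c pos with m zero in m0
  ... | false = let (k , mk , ck) = positive n (m ∘ suc) (c ∘ suc) pos in suc k , mk , ck
  ... | true with ⊔-sel (c zero) (maxOn n (m ∘ suc) (c ∘ suc))
  ...   | inj₁ head = zero , m0 , sym head
  ...   | inj₂ tail = let (k , mk , ck) = positive n (m ∘ suc) (c ∘ suc) (subst (0 <_) tail pos)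
                      in suc k , mk , trans ck (sym tail)

nextAbove : ∀ n → (Fin n → Bool) → (Fin n → ℕ) → ℕ → ℕ → ℕ
nextAbove zero    m c D x = D
nextAbove (suc n) m c D x =
  (if m zero ∧ ⌊ x <? c zero ⌋ then c zero else D) ⊓ nextAbove n (m ∘ suc) (c ∘ suc) D x

nextAbove-above : ∀ n m c D x → x < D → x < nextAbove n m c D x
nextAbove-above zero    m c D x x<D = x<D
nextAbove-above (suc n) m c D x x<D with m zero | x <? c zero
... | true  | yes x<c0 = ⊓-glb x<c0 (nextAbove-above n (m ∘ suc) (c ∘ suc) D x x<D)
... | true  | no _     = ⊓-glb x<D (nextAbove-above n (m ∘ suc) (c ∘ suc) D x x<D)
... | false | _        = ⊓-glb x<D (nextAbove-above n (m ∘ suc) (c ∘ suc) D x x<D)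

nextAbove-least : ∀ n m c D x (k : Fin n) → m k ≡ true → x < c k → nextAbove n m c D x ≤ c k
nextAbove-least (suc n) m c D x zero mk x<ck with m zero | x <? c zero
... | true  | yes _   = m⊓n≤m _ _
... | true  | no x≮ck = ⊥-elim (x≮ck x<ck)
nextAbove-least (suc n) m c D x zero () x<ck | false | _
nextAbove-least (suc n) m c D x (suc k) mk x<ck =
  ≤-trans (m⊓n≤n _ _) (nextAbove-least n (m ∘ suc) (c ∘ suc) D x k mk x<ck)

nextAbove-attained : ∀ n m c D x → nextAbove n m c D x < D →
  Σ[ k ∈ Fin n ] (m k ≡ true × x < c k × c k ≡ nextAbove n m c D x)
nextAbove-attained zero    m c D x N<D = ⊥-elim (<-irrefl refl N<D)
nextAbove-attained (suc n) m c D x N<D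
  with ⊓-sel (if m zero ∧ ⌊ x <? c zero ⌋ then c zero else D) (nextAbove n (m ∘ suc) (c ∘ suc) D x)
... | inj₂ tail = let (k , mk , x<ck , ck) = nextAbove-attained n (m ∘ suc) (c ∘ suc) D x (subst (_< D) tail N<D)
                  in suc k , mk , x<ck , trans ck (sym tail)
... | inj₁ head with m zero in m0 | x <? c zero
...   | true  | yes x<c0 = zero , m0 , x<c0 , sym head
...   | true  | no _     = ⊥-elim (<-irrefl head N<D)
...   | false | _        = ⊥-elim (<-irrefl head N<D)

+-<⇒<-∸ : ∀ x y c → x + c < y → x < y ∸ c
+-<⇒<-∸ x y c x+c<y = +-cancelʳ-< c x (y ∸ c) (subst (x + c <_) (sym (m∸n+n≡m c≤y)) x+c<y)
  where
  c≤y : c ≤ y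
  c≤y = ≤-trans (m≤n+m c x) (<⇒≤ x+c<y)

loose-arith : ∀ c N T → c ≤ N → N ≤ T → T ∸ c < 2 * (T ∸ N) → 2 * N < T + c
loose-arith c N T c≤N N≤T loose with m≤n⇒∃[o]m+o≡n c≤N | m≤n⇒∃[o]m+o≡n N≤T
... | L , refl | K , refl =
  subst₂ _<_ (sym (double c L)) (sym (regroup c L K)) (+-monoʳ-< (c + L) c+L<K+c)
  where
  double : ∀ c L → 2 * (c + L) ≡ (c + L) + (c + L)
  double = solve-∀
  regroup : ∀ c L K → c + L + K + c ≡ (c + L) + (K + c)
  regroup = solve-∀
  L+K<2K : L + K < 2 * K
  L+K<2K = subst₂ _<_ (trans (cong (_∸ c) (+-assoc c L K)) (m+n∸m≡n c (L + K)))
                      (cong (2 *_) (m+n∸m≡n (c + L) K)) loose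
  L<K : L < K
  L<K = +-cancelʳ-< K L K (subst (L + K <_) (cong (K +_) (+-identityʳ K)) L+K<2K)
  c+L<K+c : c + L < K + c
  c+L<K+c = subst (c + L <_) (+-comm c K) (+-monoʳ-< c L<K)

double-split : ∀ c x → 2 * (c + x) ≡ 2 * x + c + c
double-split = solve-∀

-- Part (b): two edges at j ∈ B, both loose at their A-ends, with colours
-- c < c′, next colours N, N′ and top colours T′ < N at the ends.
slow-arith : ∀ c c′ N′ T′ N → c < c′ → c′ ≤ N′ → 2 * N′ < T′ + c′ → T′ < N → (N′ ∸ c′) ≪ (N ∸ c)
slow-arith c c′ N′ T′ N c<c′ c′≤N′ loose T′<N = twice-below⇒≪ (+-<⇒<-∸ _ _ _ chain)
  where
  x = N′ ∸ c′
  2x+c′<T′ : 2 * x + c′ < T′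
  2x+c′<T′ = +-cancelʳ-< c′ (2 * x + c′) T′
    (subst (_< T′ + c′) (trans (cong (2 *_) (sym (m+[n∸m]≡n c′≤N′))) (double-split c′ x)) loose)
  chain : 2 * x + c < N
  chain = <-trans (+-monoʳ-< (2 * x) c<c′) (<-trans 2x+c′<T′ T′<N)

-- Part (c): an edge of colour c loose at its B-end (top T, next N), whose
-- A-end has top colour t with c ≤ t ≤ T, and another such edge whose next
-- colour N′ exceeds T.
fast-arith : ∀ c t T N N′ → c ≤ t → t ≤ T → 2 * N < T + c → T < N′ → (N ∸ t) ≪ (N′ ∸ t)
fast-arith c t T N N′ c≤t t≤T loose T<N′ with N ≤? t
... | yes N≤t = twice-below⇒≪ (subst (_< N′ ∸ t) (sym (cong (2 *_) (m≤n⇒m∸n≡0 N≤t)))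
                                       (m<n⇒0<n∸m (≤-<-trans t≤T T<N′)))
... | no N≰t = twice-below⇒≪ (+-<⇒<-∸ _ _ _ chain)
  where
  x = N ∸ t
  2x+2t<T+t : 2 * x + t + t < T + t
  2x+2t<T+t = <-≤-trans
    (subst (_< T + c) (trans (cong (2 *_) (sym (m+[n∸m]≡n (<⇒≤ (≰⇒> N≰t))))) (double-split t x)) loose)
    (+-monoʳ-≤ T c≤t)
  chain : 2 * x + t < N′
  chain = <-trans (+-cancelʳ-< t (2 * x + t) T 2x+2t<T+t) T<N′

numEdges-∑ : ∀ {a b} (G : BipGraph a b) → numEdges G ≡ ∑[ i < a ] ∑[ j < b ] ind (adj G i j)
numEdges-∑ {a} {b} G = trans (sum-tabulate a id _) (∑-cong a (λ i → sum-tabulate b id _))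
  where
  sum-tabulate : ∀ {A : Set} n (g : Fin n → A) (f : A → ℕ) → sum (map f (tabulate g)) ≡ ∑[ i < n ] f (g i)
  sum-tabulate zero    g f = refl
  sum-tabulate (suc n) g f = cong (f (g zero) +_) (sum-tabulate n (g ∘ suc) f)

proper-injectiveᴬ : ∀ {a b d} {G : BipGraph a b} {χ : Colouring a b d} → Proper G χ →
  ∀ {i j j′} → Edge G i j → Edge G i j′ → χ i j ≡ χ i j′ → j ≡ j′
proper-injectiveᴬ (properᴬ , _) {i} {j} {j′} e e′ χ≡ with j ≟ᶠ j′
... | yes j≡j′ = j≡j′
... | no j≢j′  = ⊥-elim (properᴬ i j j′ e e′ j≢j′ χ≡)

proper-injectiveᴮ : ∀ {a b d} {G : BipGraph a b} {χ : Colouring a b d} → Proper G χ →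
  ∀ {i i′ j} → Edge G i j → Edge G i′ j → χ i j ≡ χ i′ j → i ≡ i′
proper-injectiveᴮ (_ , properᴮ) {i} {i′} {j} e e′ χ≡ with i ≟ᶠ i′
... | yes i≡i′ = i≡i′
... | no i≢i′  = ⊥-elim (properᴮ i i′ j e e′ i≢i′ χ≡)

module AColours {a b d : ℕ} (G : BipGraph a b) (χ : Colouring a b d) where

  col : Fin a → Fin b → ℕ
  col i j = toℕ (χ i j)

  top : Fin a → ℕ
  top i = maxOn b (adj G i) (col i)

  next : Fin a → ℕ → ℕ
  next i c = nextAbove b (adj G i) (col i) d c

  tight : Fin a → Fin b → Bool
  tight i j = ⌊ 2 * (top i ∸ next i (col i j)) ≤? top i ∸ col i j ⌋

  col<d : ∀ i j → col i j < d
  col<d i j = toℕ<n (χ i j)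

  col≤top : ∀ {i j} → Edge G i j → col i j ≤ top i
  col≤top {i} {j} e = maxOn-upper b (adj G i) (col i) j e

  top-edge : ∀ {i j} → Edge G i j → Σ[ k ∈ Fin b ] (Edge G i k × col i k ≡ top i)
  top-edge {i} {j} e = maxOn-attained b (adj G i) (col i) j e

  top<d : ∀ {i j} → Edge G i j → top i < d
  top<d e = let (k , _ , top≡) = top-edge e in subst (_< d) top≡ (col<d _ k)

  col<next : ∀ i j → col i j < next i (col i j)
  col<next i j = nextAbove-above b (adj G i) (col i) d (col i j) (col<d i j)

  next-least : ∀ {i j k} → Edge G i k → col i j < col i k → next i (col i j) ≤ col i k
  next-least {i} {j} {k} e = nextAbove-least b (adj G i) (col i) d (col i j) k e

  next-edge : ∀ {i j} → Edge G i j → col i j < top i →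
    Σ[ k ∈ Fin b ] (Edge G i k × col i j < col i k × col i k ≡ next i (col i j))
  next-edge {i} {j} e below-top = nextAbove-attained b (adj G i) (col i) d (col i j) next<d
    where
    next<d : next i (col i j) < d
    next<d = let (k , eₖ , top≡) = top-edge e in
      ≤-<-trans (next-least eₖ (subst (col i j <_) (sym top≡) below-top)) (col<d i k)

  next≤top : ∀ {i j} → Edge G i j → col i j < top i → next i (col i j) ≤ top i
  next≤top e below-top = let (k , eₖ , _ , next≡) = next-edge e below-top in
    subst (_≤ _) next≡ (col≤top eₖ)

  -- The top edge is tight (T(i) − N(i, T(i)) = 0); so loose edges lie below the top.
  loose⇒below-top : ∀ {i j} → Edge G i j → tight i j ≡ false → col i j < top i
  loose⇒below-top {i} {j} e loose with m≤n⇒m<n∨m≡n (col≤top e)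
  ... | inj₁ below-top = below-top
  ... | inj₂ at-top = ⊥-elim (refutation (_ ≤? _) loose (subst (_≤ top i ∸ col i j) (sym top-gap≡0) z≤n))
    where
    top-gap≡0 : 2 * (top i ∸ next i (col i j)) ≡ 0
    top-gap≡0 = cong (2 *_) (m≤n⇒m∸n≡0 (<⇒≤ (subst (_< next i (col i j)) at-top (col<next i j))))

  loose-bound : ∀ {i j} → Edge G i j → tight i j ≡ false → 2 * next i (col i j) < top i + col i j
  loose-bound {i} {j} e loose = loose-arith _ _ _ (<⇒≤ (col<next i j)) (next≤top e (loose⇒below-top e loose))
                                  (≰⇒> (refutation (_ ≤? _) loose))

  col-injective : Proper G χ → ∀ {i j j′} → Edge G i j → Edge G i j′ → col i j ≡ col i j′ → j ≡ j′
  col-injective proper e e′ = proper-injectiveᴬ proper e e′ ∘ toℕ-injective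

  interval-disjoint : Proper G χ → ∀ {i j j′ c} → Edge G i j → Edge G i j′ →
    col i j ≤ c → c < next i (col i j) → col i j′ ≤ c → c < next i (col i j′) → j ≡ j′
  interval-disjoint proper {i} {j} {j′} e e′ l u l′ u′ with <-cmp (col i j) (col i j′)
  ... | tri≈ _ col≡ _ = col-injective proper e e′ col≡
  ... | tri< lt _ _ = ⊥-elim (<-irrefl refl (<-≤-trans u (≤-trans (next-least e′ lt) l′)))
  ... | tri> _ _ gt = ⊥-elim (<-irrefl refl (<-≤-trans u′ (≤-trans (next-least e gt) l)))

  -- The tight edges at a vertex form a doubling set with values T(i) − χ(ij):
  -- for χ(ij) < χ(ij′) we have N(i, χ(ij)) ≤ χ(ij′), so tightness of ij gives
  -- 2 (T(i) − χ(ij′)) ≤ T(i) − χ(ij).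
  tight-small : Proper G χ → 1 ≤ d → ∀ i → 2 ^ ∑[ j < b ] ind (adj G i j ∧ tight i j) ≤ 4 * d
  tight-small proper 1≤d i = doubling-small P μ d 1≤d μ<d
    (doubling-by-key P μ (col i) (λ p q Pp Pq → col-injective proper (edge Pp) (edge Pq)) ordered)
    where
    P : Fin b → Bool
    P j = adj G i j ∧ tight i j
    μ : Fin b → ℕ
    μ j = top i ∸ col i j
    edge : ∀ {j} → P j ≡ true → Edge G i j
    edge = proj₁ ∘ ∧-true
    μ<d : ∀ j → P j ≡ true → μ j < d
    μ<d j Pj = ≤-<-trans (m∸n≤m (top i) (col i j)) (top<d (edge Pj))
    ordered : ∀ p q → P p ≡ true → P q ≡ true → p ≢ q → col i p < col i q → μ p ≪ μ q ⊎ μ q ≪ μ p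
    ordered p q Pp Pq _ lt = inj₂
      ( ∸-monoʳ-< lt (col≤top (edge Pq))
      , ≤-trans (*-monoʳ-≤ 2 (∸-monoʳ-≤ (top i) (next-least (edge Pq) lt))) (witness (_ ≤? _) (proj₂ (∧-true Pp))) )

ind-split : ∀ x t → ind x ≤ ind (x ∧ t) + ind (x ∧ not t)
ind-split false t     = z≤n
ind-split true  true  = s≤s z≤n
ind-split true  false = s≤s z≤n

-- Part (a).  A triple (i, j, i′) is *upper* if ij and i′j are
-- edges with χ(ij) ≤ χ(i′j).  With no heavy path there are at most 2d upper
-- triples for each i, and every pair of edges at j ∈ B is upper in some order.
module HeavyPathFree {a b d : ℕ} (G : BipGraph a b) (χ : Colouring a b d)
                     (proper : Proper G χ) (no-heavy : ¬ HeavyPath G χ) where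
  open AColours G χ

  -- If ij is not the top edge at i, every other edge i′j has colour below
  -- N(i, χ(ij)); otherwise the next edge at i, ij and i′j form a heavy path.
  below-next : ∀ {i j i′} → Edge G i j → col i j < top i → Edge G i′ j → i ≢ i′ →
    col i′ j < next i (col i j)
  below-next {i} {j} {i′} e below-top e′ i≢i′ with next-edge e below-top
  ... | k , eₖ , col<colₖ , colₖ≡next with next i (col i j) ≤? col i′ j
  ... | no next≰col′ = ≰⇒> next≰col′
  ... | yes next≤col′ = ⊥-elim (no-heavy record
    { v₀ = k ; v₁ = i ; v₂ = j ; v₃ = i′
    ; e₁ = eₖ ; e₂ = e ; e₃ = e′
    ; d₀₂ = λ { refl → <-irrefl refl col<colₖ }
    ; d₁₃ = i≢i′
    ; c₂<c₁ = col<colₖ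
    ; c₁≤c₃ = subst (_≤ col i′ j) (sym colₖ≡next) next≤col′ })

  upper : Fin a → Fin b → Fin a → Bool
  upper i j i′ = adj G i j ∧ adj G i′ j ∧ ⌊ col i j ≤? col i′ j ⌋

  upper-edges : ∀ {i j i′} → upper i j i′ ≡ true → Edge G i j × Edge G i′ j × col i j ≤ col i′ j
  upper-edges {i} {j} {i′} u = let (e , rest) = ∧-true u ; (e′ , ordered) = ∧-true rest in
    e , e′ , witness (col i j ≤? col i′ j) ordered

  at-top : Fin a → Fin b → Bool
  at-top i j = ⌊ col i j ≟ top i ⌋

  same-end : ∀ {i j j′ i₁ i₂} → j ≡ j′ → upper i j i₁ ≡ true → upper i j′ i₂ ≡ true →
    χ i₁ j ≡ χ i₂ j′ → j ≡ j′ × i₁ ≡ i₂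
  same-end refl u₁ u₂ χ≡ = refl , proper-injectiveᴮ proper (proj₁ (proj₂ (upper-edges u₁))) (proj₁ (proj₂ (upper-edges u₂))) χ≡

  -- Upper triples through the top edge at i: j is the top edge, so the colour
  -- χ(i′j) determines the triple.
  upper-top : ∀ i → ∑[ j < b ] ∑[ i′ < a ] ind (upper i j i′ ∧ at-top i j) ≤ d
  upper-top i = pigeonhole b a d _ (λ j i′ → χ i′ j) injective
    where
    injective : ∀ j i₁ j′ i₂ → (upper i j i₁ ∧ at-top i j) ≡ true → (upper i j′ i₂ ∧ at-top i j′) ≡ true →
      χ i₁ j ≡ χ i₂ j′ → j ≡ j′ × i₁ ≡ i₂
    injective j i₁ j′ i₂ t₁ t₂ =
      let (u₁ , top₁) = ∧-true t₁ ; (u₂ , top₂) = ∧-true t₂ in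
      same-end (col-injective proper (proj₁ (upper-edges u₁)) (proj₁ (upper-edges u₂))
                  (trans (witness (_ ≟ _) top₁) (sym (witness (_ ≟ _) top₂)))) u₁ u₂

  -- Upper triples through a non-top edge ij: the colour χ(i′j) lies in the
  -- interval [χ(ij), N(i, χ(ij))), and these intervals are disjoint.
  upper-below-top : ∀ i → ∑[ j < b ] ∑[ i′ < a ] ind (upper i j i′ ∧ not (at-top i j)) ≤ d
  upper-below-top i = pigeonhole b a d _ (λ j i′ → χ i′ j) injective
    where
    in-interval : ∀ {j i′} → upper i j i′ ≡ true → at-top i j ≡ false → col i′ j < next i (col i j)
    in-interval {j} {i′} u not-top with upper-edges u | i ≟ᶠ i′
    ... | _ , _ , _ | yes refl = col<next i j
    ... | e , e′ , _ | no i≢i′ = below-next e below-top e′ i≢i′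
      where
      below-top : col i j < top i
      below-top with m≤n⇒m<n∨m≡n (col≤top e)
      ... | inj₁ lt = lt
      ... | inj₂ eq = ⊥-elim (refutation (_ ≟ _) not-top eq)
    injective : ∀ j i₁ j′ i₂ → (upper i j i₁ ∧ not (at-top i j)) ≡ true → (upper i j′ i₂ ∧ not (at-top i j′)) ≡ true →
      χ i₁ j ≡ χ i₂ j′ → j ≡ j′ × i₁ ≡ i₂
    injective j i₁ j′ i₂ t₁ t₂ χ≡ =
      let (u₁ , nt₁) = ∧-true t₁ ; (u₂ , nt₂) = ∧-true t₂
          (e₁ , _ , l₁) = upper-edges u₁ ; (e₂ , _ , l₂) = upper-edges u₂
          col≡ = cong toℕ χ≡
      in same-end (interval-disjoint proper e₁ e₂ l₁ (in-interval u₁ (not-true nt₁))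
                     (subst (col i j′ ≤_) (sym col≡) l₂)
                     (subst (_< next i (col i j′)) (sym col≡) (in-interval u₂ (not-true nt₂)))) u₁ u₂ χ≡

  upper-count : ∀ i → ∑[ j < b ] ∑[ i′ < a ] ind (upper i j i′) ≤ d + d
  upper-count i = begin
    ∑[ j < b ] ∑[ i′ < a ] ind (upper i j i′)
      ≤⟨ ∑-mono b (λ j → ∑-mono a (λ i′ → ind-split (upper i j i′) (at-top i j))) ⟩
    ∑[ j < b ] ∑[ i′ < a ] (ind (upper i j i′ ∧ at-top i j) + ind (upper i j i′ ∧ not (at-top i j)))
      ≡⟨ trans (∑-cong b (λ j → ∑-distrib-+ a _ _)) (∑-distrib-+ b _ _) ⟩
    _ ≤⟨ +-mono-≤ (upper-top i) (upper-below-top i) ⟩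
    d + d ∎
    where open ≤-Reasoning

  degree : Fin b → ℕ
  degree j = ∑[ i < a ] ind (adj G i j)

  upper-pairs : Fin b → ℕ
  upper-pairs j = ∑[ i < a ] ∑[ i′ < a ] ind (upper i j i′)

  -- Each ordered pair of edges at j is upper one way or the other.
  degree-square : ∀ j → degree j * degree j ≤ upper-pairs j + upper-pairs j
  degree-square j = begin
    degree j * degree j
      ≡⟨ ∑-product a a _ _ ⟩
    ∑[ i < a ] ∑[ i′ < a ] (ind (adj G i j) * ind (adj G i′ j))
      ≤⟨ ∑-mono a (λ i → ∑-mono a (λ i′ → pair-upper (adj G i j) (adj G i′ j) _ _ (≤?-flip (col i j) (col i′ j)))) ⟩
    ∑[ i < a ] ∑[ i′ < a ] (ind (upper i j i′) + ind (upper i′ j i))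
      ≡⟨ trans (∑-cong a (λ i → ∑-distrib-+ a _ _)) (∑-distrib-+ a _ _) ⟩
    upper-pairs j + ∑[ i < a ] ∑[ i′ < a ] ind (upper i′ j i)
      ≡⟨ cong (upper-pairs j +_) (∑-swap a a (λ i i′ → ind (upper i′ j i))) ⟩
    upper-pairs j + upper-pairs j ∎
    where
    open ≤-Reasoning
    pair-upper : ∀ x y (p q : Bool) → (p ≡ false → q ≡ true) → ind x * ind y ≤ ind (x ∧ y ∧ p) + ind (y ∧ x ∧ q)
    pair-upper false y     p     q flip = z≤n
    pair-upper true  false p     q flip = z≤n
    pair-upper true  true  true  q flip = s≤s z≤n
    pair-upper true  true  false q flip rewrite flip refl = s≤s z≤n

  degree-squares : ∑[ j < b ] (degree j * degree j) ≤ a * (d + d) + a * (d + d)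
  degree-squares = begin
    ∑[ j < b ] (degree j * degree j)          ≤⟨ ∑-mono b degree-square ⟩
    ∑[ j < b ] (upper-pairs j + upper-pairs j) ≡⟨ ∑-distrib-+ b upper-pairs upper-pairs ⟩
    ∑ b upper-pairs + ∑ b upper-pairs         ≡⟨ cong (λ x → x + x) by-first-end ⟩
    triples + triples                         ≤⟨ +-mono-≤ triples≤ triples≤ ⟩
    a * (d + d) + a * (d + d)                 ∎
    where
    open ≤-Reasoning
    triples = ∑[ i < a ] ∑[ j < b ] ∑[ i′ < a ] ind (upper i j i′)
    by-first-end : ∑ b upper-pairs ≡ triples
    by-first-end = ∑-swap b a (λ j i → ∑[ i′ < a ] ind (upper i j i′))
    triples≤ : triples ≤ a * (d + d)
    triples≤ = ≤-trans (∑-mono a upper-count) (≤-reflexive (∑-const a (d + d)))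

  edges-squared : numEdges G ^ 2 ≤ 4 * d * a * b
  edges-squared = begin
    numEdges G ^ 2                       ≡⟨ cong (numEdges G *_) (*-identityʳ (numEdges G)) ⟩
    numEdges G * numEdges G              ≡⟨ cong (λ x → x * x) by-B ⟩
    ∑ b degree * ∑ b degree              ≤⟨ cauchy-schwarz b degree ⟩
    b * ∑[ j < b ] (degree j * degree j) ≤⟨ *-monoʳ-≤ b degree-squares ⟩
    b * (a * (d + d) + a * (d + d))      ≡⟨ normalise a b d ⟩
    4 * d * a * b                        ∎
    where
    open ≤-Reasoning
    by-B : numEdges G ≡ ∑ b degree
    by-B = trans (numEdges-∑ G) (∑-swap a b (λ i j → ind (adj G i j)))
    normalise : ∀ a b d → b * (a * (d + d) + a * (d + d)) ≡ 4 * d * a * b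
    normalise = solve-∀

four-ab≤square : ∀ a b d → 4 * d * a * b ≤ (a + b) ^ 2 * d
four-ab≤square a b d = subst₂ _≤_ (sym (four-ab a b d)) refl
  (*-monoˡ-≤ d (subst (2 * (a * b) + 2 * (a * b) ≤_) (sym (square-sum a b)) (+-monoˡ-≤ (2 * (a * b)) (am-gm a b))))
  where
  four-ab : ∀ a b d → 4 * d * a * b ≡ (2 * (a * b) + 2 * (a * b)) * d
  four-ab = solve-∀
  square-sum : ∀ a b → (a + b) * ((a + b) * 1) ≡ a * a + b * b + 2 * (a * b)
  square-sum = solve-∀

charge-to-ends : ∀ {a b} (G : BipGraph a b) (f g : Fin a → Fin b → ℕ) M →
  (∀ i j → ind (adj G i j) ≤ f i j + g i j) →
  (∀ i → 2 ^ ∑[ j < b ] f i j ≤ M) → (∀ j → 2 ^ ∑[ i < a ] g i j ≤ M) →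
  2 ^ numEdges G ≤ M ^ (a + b)
charge-to-ends {a} {b} G f g M split f-small g-small = begin
  2 ^ numEdges G
    ≡⟨ cong (2 ^_) (numEdges-∑ G) ⟩
  2 ^ ∑[ i < a ] ∑[ j < b ] ind (adj G i j)
    ≤⟨ ^-monoʳ-≤ 2 (∑-mono a (λ i → ∑-mono b (split i))) ⟩
  2 ^ ∑[ i < a ] ∑[ j < b ] (f i j + g i j)
    ≡⟨ cong (2 ^_) (trans (∑-cong a (λ i → ∑-distrib-+ b (f i) (g i))) (∑-distrib-+ a _ _)) ⟩
  2 ^ (∑[ i < a ] ∑ b (f i) + ∑[ i < a ] ∑[ j < b ] g i j)
    ≡⟨ cong (λ x → 2 ^ (∑[ i < a ] ∑ b (f i) + x)) (∑-swap a b g) ⟩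
  2 ^ (∑[ i < a ] ∑ b (f i) + ∑[ j < b ] ∑[ i < a ] g i j)
    ≡⟨ ^-distribˡ-+-* 2 (∑[ i < a ] ∑ b (f i)) _ ⟩
  2 ^ ∑[ i < a ] ∑ b (f i) * 2 ^ ∑[ j < b ] ∑[ i < a ] g i j
    ≤⟨ *-mono-≤ (2^∑≤ a _ M f-small) (2^∑≤ b _ M g-small) ⟩
  M ^ a * M ^ b
    ≡⟨ sym (^-distribˡ-+-* M a b) ⟩
  M ^ (a + b) ∎
  where open ≤-Reasoning

-- Part (b).  Every edge is tight at its A-end or loose there; the tight
-- edges are charged to A, the loose ones to B.
module SlowWalkFree {a b d : ℕ} (G : BipGraph a b) (χ : Colouring a b d)
                    (proper : Proper G χ) (no-slow : ¬ SlowWalk G χ) where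
  open AColours G χ

  -- Two edges pj, qj below the top at p and q with χ(pj) < χ(qj): otherwise
  -- the next edge at p, pj, qj and the top edge at q form a slow walk.
  top-below-next : ∀ {j p q} → Edge G p j → Edge G q j → p ≢ q → col p j < col q j →
    col p j < top p → col q j < top q → top q < next p (col p j)
  top-below-next {j} {p} {q} eₚ e_q p≢q lt below-topₚ below-top_q
    with next-edge eₚ below-topₚ | top-edge e_q
  ... | k₁ , e₁ , col<col₁ , col₁≡next | k₂ , e₂ , col₂≡top with next p (col p j) ≤? top q
  ... | no next≰top = ≰⇒> next≰top
  ... | yes next≤top = ⊥-elim (no-slow record
    { v₀ = k₁ ; v₁ = p ; v₂ = j ; v₃ = q ; v₄ = k₂
    ; e₁ = e₁ ; e₂ = eₚ ; e₃ = e_q ; e₄ = e₂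
    ; d₀₂ = λ { refl → <-irrefl refl col<col₁ }
    ; d₁₃ = p≢q
    ; d₂₄ = λ { refl → <-irrefl col₂≡top below-top_q }
    ; c₂<c₃ = lt
    ; c₃<c₄ = subst (col q j <_) (sym col₂≡top) below-top_q
    ; c₂<c₁ = col<col₁
    ; c₁≤c₄ = subst₂ _≤_ (sym col₁≡next) (sym col₂≡top) next≤top })

  loose-small : 1 ≤ d → ∀ j → 2 ^ ∑[ i < a ] ind (adj G i j ∧ not (tight i j)) ≤ 4 * d
  loose-small 1≤d j = doubling-small P μ d 1≤d μ<d (doubling-by-key P μ (λ i → col i j) same-colour ordered)
    where
    P : Fin a → Bool
    P i = adj G i j ∧ not (tight i j)
    μ : Fin a → ℕ
    μ i = next i (col i j) ∸ col i j
    loose-edge : ∀ {i} → P i ≡ true → Edge G i j × tight i j ≡ false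
    loose-edge Pi = let (e , nt) = ∧-true Pi in e , not-true nt
    μ<d : ∀ i → P i ≡ true → μ i < d
    μ<d i Pi = let (e , loose) = loose-edge Pi ; (k , _ , _ , colₖ≡next) = next-edge e (loose⇒below-top e loose) in
      ≤-<-trans (m∸n≤m (next i (col i j)) (col i j)) (subst (_< d) colₖ≡next (col<d i k))
    same-colour : ∀ p q → P p ≡ true → P q ≡ true → col p j ≡ col q j → p ≡ q
    same-colour p q Pp Pq = proper-injectiveᴮ proper (proj₁ (loose-edge Pp)) (proj₁ (loose-edge Pq)) ∘ toℕ-injective
    ordered : ∀ p q → P p ≡ true → P q ≡ true → p ≢ q → col p j < col q j → μ p ≪ μ q ⊎ μ q ≪ μ p
    ordered p q Pp Pq p≢q lt =
      let (eₚ , looseₚ) = loose-edge Pp ; (e_q , loose_q) = loose-edge Pq in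
      inj₂ (slow-arith (col p j) (col q j) (next q (col q j)) (top q) (next p (col p j)) lt
              (<⇒≤ (col<next q j)) (loose-bound e_q loose_q)
              (top-below-next eₚ e_q p≢q lt (loose⇒below-top eₚ looseₚ) (loose⇒below-top e_q loose_q)))

  edges-bound : 1 ≤ d → 2 ^ numEdges G ≤ (4 * d) ^ (a + b)
  edges-bound 1≤d = charge-to-ends G (λ i j → ind (adj G i j ∧ tight i j)) (λ i j → ind (adj G i j ∧ not (tight i j)))
    (4 * d) (λ i j → ind-split (adj G i j) (tight i j)) (tight-small proper 1≤d) (loose-small 1≤d)

transpose : ∀ {a b} → BipGraph a b → BipGraph b a
transpose G = record { adj = λ j i → adj G i j }

transposeᶜ : ∀ {a b d} → Colouring a b d → Colouring b a d
transposeᶜ χ j i = χ i j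

transpose-proper : ∀ {a b d} {G : BipGraph a b} {χ : Colouring a b d} → Proper G χ → Proper (transpose G) (transposeᶜ χ)
transpose-proper (properᴬ , properᴮ) = (λ j i i′ → properᴮ i i′ j) , (λ j j′ i → properᴬ i j j′)

transpose-fast : ∀ {a b d} {G : BipGraph a b} {χ : Colouring a b d} →
  FastWalkA (transpose G) (transposeᶜ χ) → FastWalkB G χ
transpose-fast w = record
  { v₀ = v₀ ; v₁ = v₁ ; v₂ = v₂ ; v₃ = v₃ ; v₄ = v₄
  ; e₁ = e₁ ; e₂ = e₂ ; e₃ = e₃ ; e₄ = e₄
  ; d₀₂ = d₀₂ ; d₁₃ = d₁₃ ; d₂₄ = d₂₄
  ; c₂<c₃ = c₂<c₃ ; c₃<c₄ = c₃<c₄ ; c₄≤c₁ = c₄≤c₁ }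
  where open FastWalkA w

module FastWalkFreeᴬ {a b d : ℕ} (G : BipGraph a b) (χ : Colouring a b d)
                     (proper : Proper G χ) (no-fast : ¬ FastWalkA G χ) where
  open AColours G χ
  module Bᵀ = AColours (transpose G) (transposeᶜ χ)

  -- Edges ip, iq with χ(ip) < χ(iq), iq below the top at q: otherwise the top
  -- edge at p, pi, iq and the next edge at q form a fast walk.
  top-below-next : ∀ {i p q} → Edge G i p → Edge G i q → p ≢ q → col i p < col i q →
    col i q < Bᵀ.top q → Bᵀ.top p < Bᵀ.next q (col i q)
  top-below-next {i} {p} {q} eₚ e_q p≢q lt below-top_q
    with Bᵀ.next-edge e_q below-top_q | Bᵀ.top-edge eₚ
  ... | k₂ , e₂ , col<col₂ , col₂≡next | k₀ , e₀ , col₀≡top with Bᵀ.next q (col i q) ≤? Bᵀ.top p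
  ... | no next≰top = ≰⇒> next≰top
  ... | yes next≤top = ⊥-elim (no-fast record
    { v₀ = k₀ ; v₁ = p ; v₂ = i ; v₃ = q ; v₄ = k₂
    ; e₁ = e₀ ; e₂ = eₚ ; e₃ = e_q ; e₄ = e₂
    ; d₀₂ = λ { refl → <-irrefl refl (<-trans lt (<-≤-trans col<col₂ c₄≤c₁)) }
    ; d₁₃ = p≢q
    ; d₂₄ = λ { refl → <-irrefl refl col<col₂ }
    ; c₂<c₃ = lt
    ; c₃<c₄ = col<col₂
    ; c₄≤c₁ = c₄≤c₁ })
    where
    c₄≤c₁ : col k₂ q ≤ col k₀ p
    c₄≤c₁ = subst₂ _≤_ (sym col₂≡next) (sym col₀≡top) next≤top

  charged : Fin a → Fin b → Bool
  charged i j = adj G i j ∧ not (Bᵀ.tight j i) ∧ ⌊ top i ≤? Bᵀ.top j ⌋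

  charged-small : 1 ≤ d → ∀ i → 2 ^ ∑[ j < b ] ind (charged i j) ≤ 4 * d
  charged-small 1≤d i = doubling-small P μ d 1≤d μ<d
    (doubling-by-key P μ (col i) (λ p q Pp Pq → col-injective proper (edge Pp) (edge Pq)) ordered)
    where
    P : Fin b → Bool
    P = charged i
    μ : Fin b → ℕ
    μ j = Bᵀ.next j (col i j) ∸ top i
    unpack : ∀ {j} → P j ≡ true → Edge G i j × Bᵀ.tight j i ≡ false × top i ≤ Bᵀ.top j
    unpack {j} Pj = let (e , rest) = ∧-true Pj ; (nt , ≤top) = ∧-true rest in
      e , not-true nt , witness (top i ≤? Bᵀ.top j) ≤top
    edge : ∀ {j} → P j ≡ true → Edge G i j
    edge = proj₁ ∘ unpack
    μ<d : ∀ j → P j ≡ true → μ j < d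
    μ<d j Pj = let (e , loose , _) = unpack Pj ; (k , _ , _ , colₖ≡next) = Bᵀ.next-edge e (Bᵀ.loose⇒below-top e loose) in
      ≤-<-trans (m∸n≤m (Bᵀ.next j (col i j)) (top i)) (subst (_< d) colₖ≡next (Bᵀ.col<d j k))
    ordered : ∀ p q → P p ≡ true → P q ≡ true → p ≢ q → col i p < col i q → μ p ≪ μ q ⊎ μ q ≪ μ p
    ordered p q Pp Pq p≢q lt =
      let (eₚ , looseₚ , topᵢ≤topₚ) = unpack Pp ; (e_q , loose_q , _) = unpack Pq in
      inj₁ (fast-arith (col i p) (top i) (Bᵀ.top p) (Bᵀ.next p (col i p)) (Bᵀ.next q (col i q))
              (col≤top eₚ) topᵢ≤topₚ (Bᵀ.loose-bound eₚ looseₚ)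
              (top-below-next eₚ e_q p≢q lt (Bᵀ.loose⇒below-top e_q loose_q)))

2^∑+≤square : ∀ n (f g : Fin n → ℕ) M → 2 ^ ∑ n f ≤ M → 2 ^ ∑ n g ≤ M → 2 ^ ∑[ i < n ] (f i + g i) ≤ M ^ 2
2^∑+≤square n f g M 2^f≤M 2^g≤M = begin
  2 ^ ∑[ i < n ] (f i + g i) ≡⟨ cong (2 ^_) (∑-distrib-+ n f g) ⟩
  2 ^ (∑ n f + ∑ n g)        ≡⟨ ^-distribˡ-+-* 2 (∑ n f) (∑ n g) ⟩
  2 ^ ∑ n f * 2 ^ ∑ n g      ≤⟨ *-mono-≤ 2^f≤M 2^g≤M ⟩
  M * M                      ≡⟨ cong (M *_) (sym (*-identityʳ M)) ⟩
  M ^ 2                      ∎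
  where open ≤-Reasoning

-- Part (c).  Every edge ij is tight at i, tight at j, or loose at both ends;
-- in the last case it is charged to the end with the smaller top colour.
-- Each vertex then carries a tight set and a charged set, each with 2^size ≤ 4d.
fast-walk-free-bound : ∀ {a b d} (G : BipGraph a b) (χ : Colouring a b d) → Proper G χ →
  1 ≤ d → ¬ FastWalk G χ → 2 ^ numEdges G ≤ (4 * d) ^ (2 * (a + b))
fast-walk-free-bound {a} {b} {d} G χ proper 1≤d no-fast =
  subst (2 ^ numEdges G ≤_) (^-*-assoc (4 * d) 2 (a + b))
    (charge-to-ends G chargeᴬ chargeᴮ ((4 * d) ^ 2) split smallᴬ smallᴮ)
  where
  open AColours G χ
  module Bᵀ = AColours (transpose G) (transposeᶜ χ)
  module Cᴬ = FastWalkFreeᴬ G χ proper (no-fast ∘ inj₁)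
  module Cᴮ = FastWalkFreeᴬ (transpose G) (transposeᶜ χ) (transpose-proper proper) (no-fast ∘ inj₂ ∘ transpose-fast)

  chargeᴬ chargeᴮ : Fin a → Fin b → ℕ
  chargeᴬ i j = ind (adj G i j ∧ tight i j) + ind (Cᴬ.charged i j)
  chargeᴮ i j = ind (adj G i j ∧ Bᵀ.tight j i) + ind (Cᴮ.charged j i)

  split : ∀ i j → ind (adj G i j) ≤ chargeᴬ i j + chargeᴮ i j
  split i j = cases (adj G i j) (tight i j) (Bᵀ.tight j i) _ _ (≤?-flip (top i) (Bᵀ.top j))
    where
    cases : ∀ x t u (p q : Bool) → (p ≡ false → q ≡ true) →
      ind x ≤ (ind (x ∧ t) + ind (x ∧ not u ∧ p)) + (ind (x ∧ u) + ind (x ∧ not t ∧ q))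
    cases false t     u     p     q flip = z≤n
    cases true  true  u     p     q flip = s≤s z≤n
    cases true  false true  p     q flip = s≤s z≤n
    cases true  false false true  q flip = s≤s z≤n
    cases true  false false false q flip rewrite flip refl = s≤s z≤n

  smallᴬ : ∀ i → 2 ^ ∑[ j < b ] chargeᴬ i j ≤ (4 * d) ^ 2
  smallᴬ i = 2^∑+≤square b (λ j → ind (adj G i j ∧ tight i j)) (ind ∘ Cᴬ.charged i) (4 * d)
    (tight-small proper 1≤d i) (Cᴬ.charged-small 1≤d i)

  smallᴮ : ∀ j → 2 ^ ∑[ i < a ] chargeᴮ i j ≤ (4 * d) ^ 2
  smallᴮ j = 2^∑+≤square a (λ i → ind (adj G i j ∧ Bᵀ.tight j i)) (ind ∘ Cᴮ.charged j) (4 * d)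
    (Bᵀ.tight-small (transpose-proper proper) 1≤d j) (Cᴮ.charged-small 1≤d j)

lemma18 : ∀ {a b d : ℕ} (G : BipGraph a b) (χ : Colouring a b d) → Proper G χ →
    (¬ HeavyPath G χ →
      (numEdges G ^ 2 ≤ 4 * d * a * b) × (4 * d * a * b ≤ (a + b) ^ 2 * d))
    × (1 ≤ d → ¬ SlowWalk G χ → 2 ^ numEdges G ≤ (4 * d) ^ (a + b))
    × (1 ≤ d → ¬ FastWalk G χ → 2 ^ numEdges G ≤ (4 * d) ^ (2 * (a + b)))
lemma18 {a} {b} {d} G χ proper =
  (λ no-heavy → HeavyPathFree.edges-squared G χ proper no-heavy , four-ab≤square a b d) ,
  (λ 1≤d no-slow → SlowWalkFree.edges-bound G χ proper no-slow 1≤d) ,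
  (λ 1≤d no-fast → fast-walk-free-bound G χ proper 1≤d no-fast)
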